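{- Let $(\alpha_n(a,k),\beta_n(a,k))_{n\ge 0}$ be a WP-Bailey pair, i.e. for all values of the parameters $a,k$ and all $n\ge 0$, \[ \beta_{n}(a,k) = \sum_{j=0}^{n}\frac{(k/a;q)_{n-j}(k;q)_{n+j}}{(q;q)_{n-j}(aq;q)_{n+j}}\alpha_{j}(a,k). \] Define \[ \alpha_{n}'(a,k)=\frac{1-a q^{2n}}{1-a}\left (\frac{k}{a} \right)^n \beta_{n}(k,a),\qquad \beta_n'(a,k)= \frac{1-k}{1-k q^{2n}}\left (\frac{k}{a} \right)^n \alpha_{n}(k,a). \] Then $(\alpha_n'(a,k),\beta_n'(a,k))$ is also a WP-Bailey pair, i.e. satisfies the same relation.
   Context: $(x;q)_n=\prod_{i=0}^{n-1}(1-xq^i)$ denotes the $q$-Pochhammer symbol. Parameters $a,k$ are indeterminates (generic, so that all denominators are nonzero). -}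

module Defs where

open import Level using (Level; _⊔_) renaming (suc to lsuc)
open import Algebra.Bundles using (CommutativeRing)
open import Data.Nat using (ℕ; zero; suc) renaming (_+_ to _+ℕ_; _∸_ to _∸ℕ_; _*_ to _*ℕ_)
open import Data.Integer using (ℤ; +_; -[1+_])
open import Relation.Nullary using (¬_)
open import Data.Product using (_×_)
open import Relation.Binary.PropositionalEquality using (_≡_)

-- A field: a commutative ring with 0 ≠ 1 and a (total) inverse operation
-- which is a genuine multiplicative inverse on nonzero elements
-- (the value of 0⁻¹ is irrelevant and left unspecified).
record Field (c ℓ : Level) : Set (lsuc (c ⊔ ℓ)) where
  field
    commutativeRing : CommutativeRing c ℓ
  open CommutativeRing commutativeRing public
  field
    _⁻¹       : Carrier → Carrier
    ⁻¹-cong   : ∀ {x y} → x ≈ y → (x ⁻¹) ≈ (y ⁻¹)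
    ⁻¹-inverse : ∀ {x} → ¬ (x ≈ 0#) → (x * (x ⁻¹)) ≈ 1#
    0≉1       : ¬ (0# ≈ 1#)

module WP {c ℓ : Level} (F : Field c ℓ) where
  open Field F

  infixl 7 _/_
  _/_ : Carrier → Carrier → Carrier
  x / y = x * (y ⁻¹)

  _^_ : Carrier → ℕ → Carrier
  x ^ zero  = 1#
  x ^ suc n = x * (x ^ n)

  _^ℤ_ : Carrier → ℤ → Carrier
  x ^ℤ (+ n)      = x ^ n
  x ^ℤ (-[1+ n ]) = (x ⁻¹) ^ suc n

  poch : Carrier → Carrier → ℕ → Carrier
  poch x q zero    = 1#
  poch x q (suc n) = poch x q n * (1# - x * (q ^ n))

  sumTo : ℕ → (ℕ → Carrier) → Carrier
  sumTo zero    f = f 0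
  sumTo (suc n) f = sumTo n f + f (suc n)

  -- Genericity of the parameters (q, a, k): nothing is zero, q is not a root
  -- of unity, and none of a, k, a/k, k/a times an integral power of q equals 1.
  -- (This is what "a, k indeterminates, all denominators nonzero" amounts to.)
  Generic : Carrier → Carrier → Carrier → Set ℓ
  Generic q a k =
    ¬ (q ≈ 0#) × ¬ (a ≈ 0#) × ¬ (k ≈ 0#) ×
    (∀ (i : ℤ) → ¬ (i ≡ + 0) → ¬ ((q ^ℤ i) ≈ 1#)) ×
    (∀ (i : ℤ) → ¬ ((a * (q ^ℤ i)) ≈ 1#)) ×
    (∀ (i : ℤ) → ¬ ((k * (q ^ℤ i)) ≈ 1#)) ×
    (∀ (i : ℤ) → ¬ (((a / k) * (q ^ℤ i)) ≈ 1#)) ×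
    (∀ (i : ℤ) → ¬ (((k / a) * (q ^ℤ i)) ≈ 1#))

  -- Families α_n(a,k): index n, then a, then k.
  Family : Set c
  Family = ℕ → Carrier → Carrier → Carrier

  IsWPBaileyPair : Carrier → Family → Family → Set (c ⊔ ℓ)
  IsWPBaileyPair q α β =
    ∀ (a k : Carrier) → Generic q a k → ∀ (n : ℕ) →
      β n a k ≈ sumTo n (λ j →
        ((poch (k / a) q (n ∸ℕ j) * poch k q (n +ℕ j))
          / (poch q q (n ∸ℕ j) * poch (a * q) q (n +ℕ j))) * α j a k)

  α′ : Carrier → Family → Family
  α′ q β n a k = ((1# - a * (q ^ (2 *ℕ n))) / (1# - a)) * ((k / a) ^ n) * β n k a

  β′ : Carrier → Family → Family
  β′ q α n a k = ((1# - k) / (1# - k * (q ^ (2 *ℕ n)))) * ((k / a) ^ n) * α n k a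

-- Substituting the WP-Bailey relation for β at (k, a) into the claimed relation for
-- (α′, β′) and interchanging the two finite sums reduces the theorem to an orthogonality
-- relation between the WP-Bailey matrices for (a, k) and for (k, a):
--   Σ_{j=i}^{n} c_{n,j}(a,k) w_j(a,k) c_{j,i}(k,a) = δ_{i,n} (1 - k)/(1 - k q^{2n}) (k/a)^n,
-- where c_{n,j}(a,k) is the WP-Bailey coefficient and w_j(a,k) = (1 - a q^{2j})/(1 - a) (k/a)^j.
-- For i < n the inner sum telescopes: its partial sum up to j is the j-th term t_j times an
-- explicit rational certificate R_j (the one Gosper's algorithm produces). The step
-- t_j R_j + t_{j+1} = t_{j+1} R_{j+1} reduces to a polynomial identity, R_i = 1, and R_n = 0
-- because of the factor 1 - q^{n-j}.
-- The diagonal term i = n is a quotient of Pochhammer symbols that collapses directly.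
module Submission where

open import Defs
open import Level using (Level)
open import Algebra.Bundles using (CommutativeRing)
open import Algebra.Solver.Ring.AlmostCommutativeRing using (fromCommutativeRing; _-Raw-AlmostCommutative⟶_)
open import Data.Nat as ℕ using (ℕ; zero; suc; _∸_; _≤_; _<_; z≤n; s≤s)
import Data.Nat.Properties as ℕ
open import Data.Nat.Tactic.RingSolver using () renaming (solve to ℕ-solve)
open import Data.Integer as ℤ using (ℤ; +_; -[1+_]; _⊖_; ∣_∣; sign; _◃_)
import Data.Integer.Properties as ℤ
open import Data.Sign as Sign using (Sign)
open import Data.List using (_∷_; [])
open import Data.Maybe using (Maybe; just; nothing)
open import Data.Product using (_,_)
open import Relation.Nullary using (¬_; yes; no)
open import Relation.Binary.PropositionalEquality as ≡ using (_≡_)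

-- The ring solver with integer coefficients, interpreted in R through fromℤ; unlike
-- coefficients taken in R itself, these let normal forms cancel, as in (1 - x) + x ≈ 1.
module IntegerCoefficientSolver {c ℓ : Level} (R : CommutativeRing c ℓ) where
  open CommutativeRing R
  open import Algebra.Properties.Ring ring
    using (-‿distribˡ-*; -‿distribʳ-*; -‿involutive; -0#≈0#; -‿+-comm)
  open import Algebra.Properties.Semiring.Mult.TCOptimised semiring
    using (_×_; 1+×; ×-homo-+; ×1-homo-*)
  open import Algebra.Properties.CommutativeSemigroup +-commutativeSemigroup using (interchange)
  open import Relation.Binary.Reasoning.Setoid setoid

  signed : Sign → Carrier → Carrier
  signed Sign.+ x = x
  signed Sign.- x = - x

  signed-cong : ∀ s {x y} → x ≈ y → signed s x ≈ signed s y
  signed-cong Sign.+ x≈y = x≈y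
  signed-cong Sign.- x≈y = -‿cong x≈y

  signed-* : ∀ s t x y → signed (s Sign.* t) (x * y) ≈ signed s x * signed t y
  signed-* Sign.+ Sign.+ x y = refl
  signed-* Sign.+ Sign.- x y = -‿distribʳ-* x y
  signed-* Sign.- Sign.+ x y = -‿distribˡ-* x y
  signed-* Sign.- Sign.- x y = begin
    x * y           ≈⟨ -‿involutive (x * y) ⟨
    - - (x * y)     ≈⟨ -‿cong (-‿distribˡ-* x y) ⟩
    - (- x * y)     ≈⟨ -‿distribʳ-* (- x) y ⟩
    - x * - y       ∎

  fromℤ : ℤ → Carrier
  fromℤ i = signed (sign i) (∣ i ∣ × 1#)

  fromℤ-◃ : ∀ s n → fromℤ (s ◃ n) ≈ signed s (n × 1#)
  fromℤ-◃ Sign.+ zero    = refl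
  fromℤ-◃ Sign.- zero    = sym -0#≈0#
  fromℤ-◃ Sign.+ (suc n) = refl
  fromℤ-◃ Sign.- (suc n) = refl

  fromℤ-homo-* : ∀ i j → fromℤ (i ℤ.* j) ≈ fromℤ i * fromℤ j
  fromℤ-homo-* i j = begin
    fromℤ (s ◃ ∣ i ∣ ℕ.* ∣ j ∣)                   ≈⟨ fromℤ-◃ s (∣ i ∣ ℕ.* ∣ j ∣) ⟩
    signed s ((∣ i ∣ ℕ.* ∣ j ∣) × 1#)             ≈⟨ signed-cong s (×1-homo-* ∣ i ∣ ∣ j ∣) ⟩
    signed s ((∣ i ∣ × 1#) * (∣ j ∣ × 1#))        ≈⟨ signed-* (sign i) (sign j) _ _ ⟩
    fromℤ i * fromℤ j                             ∎
    where
    s = sign i Sign.* sign j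

  1+x-[1+y]≈x-y : ∀ x y → (1# + x) - (1# + y) ≈ x - y
  1+x-[1+y]≈x-y x y = begin
    (1# + x) - (1# + y)       ≈⟨ +-congˡ (-‿+-comm 1# y) ⟨
    (1# + x) + (- 1# - y)     ≈⟨ interchange 1# x (- 1#) (- y) ⟩
    (1# - 1#) + (x - y)       ≈⟨ +-congʳ (-‿inverseʳ 1#) ⟩
    0# + (x - y)              ≈⟨ +-identityˡ (x - y) ⟩
    x - y                     ∎

  fromℤ-⊖ : ∀ m n → fromℤ (m ⊖ n) ≈ m × 1# - n × 1#
  fromℤ-⊖ m zero = begin
    fromℤ (m ⊖ 0)      ≡⟨ ≡.cong fromℤ (ℤ.⊖-≥ {m} z≤n) ⟩
    m × 1#             ≈⟨ +-identityʳ _ ⟨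
    m × 1# + 0#        ≈⟨ +-congˡ -0#≈0# ⟨
    m × 1# - 0#        ∎
  fromℤ-⊖ zero (suc n) = sym (+-identityˡ _)
  fromℤ-⊖ (suc m) (suc n) = begin
    fromℤ (suc m ⊖ suc n)              ≡⟨ ≡.cong fromℤ (ℤ.[1+m]⊖[1+n]≡m⊖n m n) ⟩
    fromℤ (m ⊖ n)                      ≈⟨ fromℤ-⊖ m n ⟩
    m × 1# - n × 1#                    ≈⟨ 1+x-[1+y]≈x-y _ _ ⟨
    (1# + m × 1#) - (1# + n × 1#)      ≈⟨ +-cong (1+× m 1#) (-‿cong (1+× n 1#)) ⟨
    suc m × 1# - suc n × 1#            ∎

  fromℤ-homo-+ : ∀ i j → fromℤ (i ℤ.+ j) ≈ fromℤ i + fromℤ j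
  fromℤ-homo-+ -[1+ m ] -[1+ n ] = begin
    - (suc (suc (m ℕ.+ n)) × 1#)    ≡⟨ ≡.cong (λ l → - (suc l × 1#)) (ℕ.+-suc m n) ⟨
    - ((suc m ℕ.+ suc n) × 1#)      ≈⟨ -‿cong (×-homo-+ 1# (suc m) (suc n)) ⟩
    - (suc m × 1# + suc n × 1#)     ≈⟨ -‿+-comm _ _ ⟨
    - (suc m × 1#) - suc n × 1#     ∎
  fromℤ-homo-+ -[1+ m ] (+ n)    = trans (fromℤ-⊖ n (suc m)) (+-comm _ _)
  fromℤ-homo-+ (+ m)    -[1+ n ] = fromℤ-⊖ m (suc n)
  fromℤ-homo-+ (+ m)    (+ n)    = ×-homo-+ 1# m n

  fromℤ-homo-‿ : ∀ i → fromℤ (ℤ.- i) ≈ - fromℤ i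
  fromℤ-homo-‿ -[1+ n ]  = sym (-‿involutive _)
  fromℤ-homo-‿ (+ zero)  = sym -0#≈0#
  fromℤ-homo-‿ (+ suc n) = refl

  ℤ-homomorphism : ℤ.+-*-rawRing -Raw-AlmostCommutative⟶ fromCommutativeRing R
  ℤ-homomorphism = record
    { ⟦_⟧    = fromℤ
    ; +-homo = fromℤ-homo-+
    ; *-homo = fromℤ-homo-*
    ; -‿homo = fromℤ-homo-‿
    ; 0-homo = refl
    ; 1-homo = refl
    }

  fromℤ-≟ : ∀ i j → Maybe (fromℤ i ≈ fromℤ j)
  fromℤ-≟ i j with i ℤ.≟ j
  ... | yes ≡.refl = just refl
  ... | no _       = nothing

  open import Algebra.Solver.Ring ℤ.+-*-rawRing (fromCommutativeRing R) ℤ-homomorphism fromℤ-≟ public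

  one : ∀ {n} → Polynomial n
  one = con (+ 1)

module FieldProperties {c ℓ : Level} (F : Field c ℓ) where
  open Field F hiding (zero)
  open WP F
  open import Relation.Binary.Reasoning.Setoid setoid
  open IntegerCoefficientSolver commutativeRing using (solve; _:=_; _:+_; _:*_; _:-_; one)

  *-≉0 : ∀ {x y} → ¬ x ≈ 0# → ¬ y ≈ 0# → ¬ x * y ≈ 0#
  *-≉0 {x} {y} x≉0 y≉0 xy≈0 = x≉0 (begin
    x                  ≈⟨ *-identityʳ x ⟨
    x * 1#             ≈⟨ *-congˡ (⁻¹-inverse y≉0) ⟨
    x * (y * y ⁻¹)     ≈⟨ *-assoc x y _ ⟨
    (x * y) * y ⁻¹     ≈⟨ *-congʳ xy≈0 ⟩
    0# * y ⁻¹          ≈⟨ zeroˡ _ ⟩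
    0#                 ∎)

  1-x≉0 : ∀ {x} → ¬ x ≈ 1# → ¬ 1# - x ≈ 0#
  1-x≉0 {x} x≉1 1-x≈0 = x≉1 (sym (begin
    1#                 ≈⟨ solve 1 (λ x → one := (one :- x) :+ x) refl x ⟩
    (1# - x) + x       ≈⟨ +-congʳ 1-x≈0 ⟩
    0# + x             ≈⟨ +-identityˡ x ⟩
    x                  ∎))

  1-cong : ∀ {x y} → x ≈ y → 1# - x ≈ 1# - y
  1-cong x≈y = +-congˡ (-‿cong x≈y)

  ⁻¹-distrib-* : ∀ {x y} → ¬ x ≈ 0# → ¬ y ≈ 0# → (x * y) ⁻¹ ≈ x ⁻¹ * y ⁻¹
  ⁻¹-distrib-* {x} {y} x≉0 y≉0 = begin
    (x * y) ⁻¹                                ≈⟨ *-identityʳ _ ⟨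
    (x * y) ⁻¹ * 1#                           ≈⟨ *-congˡ 1≈[xx⁻¹][yy⁻¹] ⟩
    (x * y) ⁻¹ * ((x * x ⁻¹) * (y * y ⁻¹))
      ≈⟨ solve 5 (λ z x y x′ y′ → z :* ((x :* x′) :* (y :* y′)) := ((x :* y) :* z) :* (x′ :* y′))
               refl ((x * y) ⁻¹) x y (x ⁻¹) (y ⁻¹) ⟩
    ((x * y) * (x * y) ⁻¹) * (x ⁻¹ * y ⁻¹)    ≈⟨ *-congʳ (⁻¹-inverse (*-≉0 x≉0 y≉0)) ⟩
    1# * (x ⁻¹ * y ⁻¹)                        ≈⟨ *-identityˡ _ ⟩
    x ⁻¹ * y ⁻¹                               ∎
    where
    1≈[xx⁻¹][yy⁻¹] : 1# ≈ (x * x ⁻¹) * (y * y ⁻¹)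
    1≈[xx⁻¹][yy⁻¹] = sym (trans (*-cong (⁻¹-inverse x≉0) (⁻¹-inverse y≉0)) (*-identityʳ 1#))

  /-cong : ∀ {x x′ y y′} → x ≈ x′ → y ≈ y′ → x / y ≈ x′ / y′
  /-cong x≈x′ y≈y′ = *-cong x≈x′ (⁻¹-cong y≈y′)

  /-*-/ : ∀ {x y u v} → ¬ y ≈ 0# → ¬ v ≈ 0# → (x / y) * (u / v) ≈ (x * u) / (y * v)
  /-*-/ {x} {y} {u} {v} y≉0 v≉0 = begin
    (x * y ⁻¹) * (u * v ⁻¹)
      ≈⟨ solve 4 (λ x y′ u v′ → (x :* y′) :* (u :* v′) := (x :* u) :* (y′ :* v′)) refl x (y ⁻¹) u (v ⁻¹) ⟩
    (x * u) * (y ⁻¹ * v ⁻¹)    ≈⟨ *-congˡ (⁻¹-distrib-* y≉0 v≉0) ⟨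
    (x * u) * (y * v) ⁻¹       ∎

  /-+-/ : ∀ {x y u v} → ¬ y ≈ 0# → ¬ v ≈ 0# → x / y + u / v ≈ (x * v + u * y) / (y * v)
  /-+-/ {x} {y} {u} {v} y≉0 v≉0 = begin
    x * y ⁻¹ + u * v ⁻¹
      ≈⟨ +-cong (*-identityʳ _) (*-identityʳ _) ⟨
    (x * y ⁻¹) * 1# + (u * v ⁻¹) * 1#
      ≈⟨ +-cong (*-congˡ (⁻¹-inverse v≉0)) (*-congˡ (⁻¹-inverse y≉0)) ⟨
    (x * y ⁻¹) * (v * v ⁻¹) + (u * v ⁻¹) * (y * y ⁻¹)
      ≈⟨ solve 6 (λ x y u v y′ v′ → (x :* y′) :* (v :* v′) :+ (u :* v′) :* (y :* y′)
                                   := (x :* v :+ u :* y) :* (y′ :* v′))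
               refl x y u v (y ⁻¹) (v ⁻¹) ⟩
    (x * v + u * y) * (y ⁻¹ * v ⁻¹)
      ≈⟨ *-congˡ (⁻¹-distrib-* y≉0 v≉0) ⟨
    (x * v + u * y) * (y * v) ⁻¹ ∎

  /-cross : ∀ {x y u v} → ¬ y ≈ 0# → ¬ v ≈ 0# → x * v ≈ u * y → x / y ≈ u / v
  /-cross {x} {y} {u} {v} y≉0 v≉0 xv≈uy = begin
    x * y ⁻¹                   ≈⟨ *-identityʳ _ ⟨
    (x * y ⁻¹) * 1#            ≈⟨ *-congˡ (⁻¹-inverse v≉0) ⟨
    (x * y ⁻¹) * (v * v ⁻¹)
      ≈⟨ solve 4 (λ x y′ v v′ → (x :* y′) :* (v :* v′) := (x :* v) :* (y′ :* v′)) refl x (y ⁻¹) v (v ⁻¹) ⟩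
    (x * v) * (y ⁻¹ * v ⁻¹)    ≈⟨ *-congʳ xv≈uy ⟩
    (u * y) * (y ⁻¹ * v ⁻¹)
      ≈⟨ solve 4 (λ u y y′ v′ → (u :* y) :* (y′ :* v′) := (u :* v′) :* (y :* y′)) refl u y (y ⁻¹) (v ⁻¹) ⟩
    (u * v ⁻¹) * (y * y ⁻¹)    ≈⟨ *-congˡ (⁻¹-inverse y≉0) ⟩
    (u * v ⁻¹) * 1#            ≈⟨ *-identityʳ _ ⟩
    u * v ⁻¹                   ∎

  ^-+ : ∀ x m n → x ^ (m ℕ.+ n) ≈ x ^ m * x ^ n
  ^-+ x zero    n = sym (*-identityˡ _)
  ^-+ x (suc m) n = trans (*-congˡ (^-+ x m n)) (sym (*-assoc x _ _))

  poch-≉0 : ∀ {x q} → (∀ s → ¬ x * q ^ s ≈ 1#) → ∀ n → ¬ poch x q n ≈ 0#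
  poch-≉0 xq^≉1 zero    1≈0 = 0≉1 (sym 1≈0)
  poch-≉0 xq^≉1 (suc n) = *-≉0 (poch-≉0 xq^≉1 n) (1-x≉0 (xq^≉1 n))

  poch-suc : ∀ x q m → poch x q (suc m) ≈ (1# - x) * poch (x * q) q m
  poch-suc x q zero = begin
    1# * (1# - x * 1#)     ≈⟨ *-identityˡ _ ⟩
    1# - x * 1#            ≈⟨ 1-cong (*-identityʳ x) ⟩
    1# - x                 ≈⟨ *-identityʳ _ ⟨
    (1# - x) * 1#          ∎
  poch-suc x q (suc m) = begin
    poch x q (suc m) * (1# - x * (q * q ^ m))
      ≈⟨ *-cong (poch-suc x q m) (1-cong (sym (*-assoc x q _))) ⟩
    ((1# - x) * poch (x * q) q m) * (1# - (x * q) * q ^ m)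
      ≈⟨ *-assoc _ _ _ ⟩
    (1# - x) * poch (x * q) q (suc m) ∎

module FiniteSums {c ℓ : Level} (F : Field c ℓ) where
  open Field F hiding (zero)
  open WP F
  open import Relation.Binary.Reasoning.Setoid setoid
  open import Algebra.Properties.CommutativeSemigroup +-commutativeSemigroup using (interchange)

  sumTo-cong : ∀ n {f g : ℕ → Carrier} → (∀ i → i ≤ n → f i ≈ g i) → sumTo n f ≈ sumTo n g
  sumTo-cong zero    f≈g = f≈g 0 z≤n
  sumTo-cong (suc n) f≈g =
    +-cong (sumTo-cong n (λ i i≤n → f≈g i (ℕ.m≤n⇒m≤1+n i≤n))) (f≈g (suc n) ℕ.≤-refl)

  sumTo-*ˡ : ∀ n x (f : ℕ → Carrier) → x * sumTo n f ≈ sumTo n (λ i → x * f i)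
  sumTo-*ˡ zero    x f = refl
  sumTo-*ˡ (suc n) x f = trans (distribˡ x _ _) (+-congʳ (sumTo-*ˡ n x f))

  sumTo-+ : ∀ n (f g : ℕ → Carrier) → sumTo n (λ i → f i + g i) ≈ sumTo n f + sumTo n g
  sumTo-+ zero    f g = refl
  sumTo-+ (suc n) f g = trans (+-congʳ (sumTo-+ n f g)) (interchange _ _ _ _)

  sumTo-0# : ∀ n → sumTo n (λ _ → 0#) ≈ 0#
  sumTo-0# zero    = refl
  sumTo-0# (suc n) = trans (+-congʳ (sumTo-0# n)) (+-identityʳ 0#)

  sumTo-last : ∀ n (f : ℕ → Carrier) → (∀ i → i < n → f i ≈ 0#) → sumTo n f ≈ f n
  sumTo-last zero    f f≈0 = refl
  sumTo-last (suc n) f f≈0 = begin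
    sumTo n f + f (suc n)
      ≈⟨ +-congʳ (sumTo-cong n (λ i i≤n → f≈0 i (s≤s i≤n))) ⟩
    sumTo n (λ _ → 0#) + f (suc n)
      ≈⟨ +-congʳ (sumTo-0# n) ⟩
    0# + f (suc n)
      ≈⟨ +-identityˡ _ ⟩
    f (suc n) ∎

  sumFrom : ℕ → ℕ → (ℕ → Carrier) → Carrier
  sumFrom i zero    f = 0#
  sumFrom i (suc l) f = sumFrom i l f + f (i ℕ.+ l)

  sumFrom-*ʳ : ∀ i l (f : ℕ → Carrier) y → sumFrom i l f * y ≈ sumFrom i l (λ j → f j * y)
  sumFrom-*ʳ i zero    f y = zeroˡ y
  sumFrom-*ʳ i (suc l) f y = trans (distribʳ y _ _) (+-congʳ (sumFrom-*ʳ i l f y))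

  sumFrom-singleton : ∀ n (f : ℕ → Carrier) → sumFrom n (suc (n ∸ n)) f ≈ f n
  sumFrom-singleton n f = begin
    sumFrom n (suc (n ∸ n)) f     ≡⟨ ≡.cong (λ l → sumFrom n (suc l) f) (ℕ.n∸n≡0 n) ⟩
    0# + f (n ℕ.+ 0)              ≈⟨ +-identityˡ _ ⟩
    f (n ℕ.+ 0)                   ≡⟨ ≡.cong f (ℕ.+-identityʳ n) ⟩
    f n                           ∎

  sumFrom-extend : ∀ {i n} (f : ℕ → Carrier) → i ≤ n →
                   sumFrom i (suc (n ∸ i)) f + f (suc n) ≈ sumFrom i (suc (suc n ∸ i)) f
  sumFrom-extend {i} {n} f i≤n = begin
    sumFrom i (suc (n ∸ i)) f + f (suc n)
      ≡⟨ ≡.cong (λ j → sumFrom i (suc (n ∸ i)) f + f j) i+[1+n∸i]≡1+n ⟨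
    sumFrom i (suc (suc (n ∸ i))) f
      ≡⟨ ≡.cong (λ l → sumFrom i (suc l) f) (ℕ.+-∸-assoc 1 i≤n) ⟨
    sumFrom i (suc (suc n ∸ i)) f ∎
    where
    i+[1+n∸i]≡1+n : i ℕ.+ suc (n ∸ i) ≡ suc n
    i+[1+n∸i]≡1+n = ≡.trans (ℕ.+-suc i (n ∸ i)) (≡.cong suc (ℕ.m+[n∸m]≡n i≤n))

  sumTo-triangle : ∀ n (g : ℕ → ℕ → Carrier) →
    sumTo n (λ j → sumTo j (g j)) ≈ sumTo n (λ i → sumFrom i (suc (n ∸ i)) (λ j → g j i))
  sumTo-triangle zero    g = sym (+-identityˡ _)
  sumTo-triangle (suc n) g = begin
    sumTo n (λ j → sumTo j (g j)) + (sumTo n (g (suc n)) + g (suc n) (suc n))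
      ≈⟨ +-congʳ (sumTo-triangle n g) ⟩
    sumTo n S + (sumTo n (g (suc n)) + g (suc n) (suc n))
      ≈⟨ +-assoc _ _ _ ⟨
    (sumTo n S + sumTo n (g (suc n))) + g (suc n) (suc n)
      ≈⟨ +-congʳ (sumTo-+ n S (g (suc n))) ⟨
    sumTo n (λ i → S i + g (suc n) i) + g (suc n) (suc n)
      ≈⟨ +-cong (sumTo-cong n (λ i → sumFrom-extend (λ j → g j i)))
                (sym (sumFrom-singleton (suc n) (λ j → g j (suc n)))) ⟩
    sumTo (suc n) (λ i → sumFrom i (suc (suc n ∸ i)) (λ j → g j i)) ∎
    where
    S : ℕ → Carrier
    S i = sumFrom i (suc (n ∸ i)) (λ j → g j i)

  sumFrom-telescope : ∀ (t H : ℕ → Carrier) {i n} → i ≤ n → H i ≈ 1# →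
    (∀ m → i ℕ.+ m < n →
       t (i ℕ.+ m) * H (i ℕ.+ m) + t (suc (i ℕ.+ m)) ≈ t (suc (i ℕ.+ m)) * H (suc (i ℕ.+ m))) →
    sumFrom i (suc (n ∸ i)) t ≈ t n * H n
  sumFrom-telescope t H {i} {n} i≤n Hi≈1 step = begin
    sumFrom i (suc (n ∸ i)) t
      ≈⟨ partial (n ∸ i) (ℕ.≤-reflexive (ℕ.m+[n∸m]≡n i≤n)) ⟩
    t (i ℕ.+ (n ∸ i)) * H (i ℕ.+ (n ∸ i))
      ≡⟨ ≡.cong (λ j → t j * H j) (ℕ.m+[n∸m]≡n i≤n) ⟩
    t n * H n ∎
    where
    partial : ∀ m → i ℕ.+ m ≤ n → sumFrom i (suc m) t ≈ t (i ℕ.+ m) * H (i ℕ.+ m)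
    partial zero _ = begin
      0# + t (i ℕ.+ 0)            ≈⟨ +-identityˡ _ ⟩
      t (i ℕ.+ 0)                 ≈⟨ *-identityʳ _ ⟨
      t (i ℕ.+ 0) * 1#            ≈⟨ *-congˡ (trans (reflexive (≡.cong H (ℕ.+-identityʳ i))) Hi≈1) ⟨
      t (i ℕ.+ 0) * H (i ℕ.+ 0)   ∎
    partial (suc m) i+1+m≤n = begin
      sumFrom i (suc m) t + t (i ℕ.+ suc m)
        ≈⟨ +-congʳ (partial m (ℕ.<⇒≤ i+m<n)) ⟩
      t (i ℕ.+ m) * H (i ℕ.+ m) + t (i ℕ.+ suc m)
        ≡⟨ ≡.cong (λ j → t (i ℕ.+ m) * H (i ℕ.+ m) + t j) (ℕ.+-suc i m) ⟩
      t (i ℕ.+ m) * H (i ℕ.+ m) + t (suc (i ℕ.+ m))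
        ≈⟨ step m i+m<n ⟩
      t (suc (i ℕ.+ m)) * H (suc (i ℕ.+ m))
        ≡⟨ ≡.cong (λ j → t j * H j) (ℕ.+-suc i m) ⟨
      t (i ℕ.+ suc m) * H (i ℕ.+ suc m) ∎
      where
      i+m<n : i ℕ.+ m < n
      i+m<n = ≡.subst (_≤ n) (ℕ.+-suc i m) i+1+m≤n

module WPBaileyInversion {c ℓ : Level} (F : Field c ℓ) where
  open Field F hiding (zero)
  open WP F
  open FieldProperties F
  open FiniteSums F
  open import Relation.Binary.Reasoning.Setoid setoid
  open IntegerCoefficientSolver commutativeRing using (solve; _:=_; _:+_; _:*_; _:-_; one)
  open import Algebra.Properties.CommutativeSemigroup *-commutativeSemigroup using (xy∙z≈xz∙y)

  coefficient : Carrier → Carrier → Carrier → ℕ → ℕ → Carrier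
  coefficient q a k d s = (poch (k / a) q d * poch k q s) / (poch q q d * poch (a * q) q s)

  weight : Carrier → Carrier → Carrier → ℕ → Carrier
  weight q a k n = ((1# - a * q ^ (2 ℕ.* n)) / (1# - a)) * (k / a) ^ n

  coefficient-zeroˡ : ∀ q a k s → coefficient q a k 0 s ≈ poch k q s / poch (a * q) q s
  coefficient-zeroˡ q a k s = /-cong (*-identityˡ _) (*-identityˡ _)

  module _ {q a : Carrier} (q^suc≉1 : ∀ s → ¬ q ^ suc s ≈ 1#) (aq^≉1 : ∀ s → ¬ a * q ^ s ≈ 1#) where

    [aq]q^≉1 : ∀ s → ¬ (a * q) * q ^ s ≈ 1#
    [aq]q^≉1 s aq·q^s≈1 = aq^≉1 (suc s) (trans (sym (*-assoc a q _)) aq·q^s≈1)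

    coefficient-denominator-≉0 : ∀ d s → ¬ poch q q d * poch (a * q) q s ≈ 0#
    coefficient-denominator-≉0 d s = *-≉0 (poch-≉0 q^suc≉1 d) (poch-≉0 [aq]q^≉1 s)

    coefficient-sucˡ : ∀ k d s → coefficient q a k (suc d) s
                                 ≈ coefficient q a k d s * ((1# - (k / a) * q ^ d) / (1# - q ^ suc d))
    coefficient-sucˡ k d s = begin
      ((P * b) * P′) / ((Q * g) * Q′)   ≈⟨ /-cong (xy∙z≈xz∙y P b P′) (xy∙z≈xz∙y Q g Q′) ⟩
      ((P * P′) * b) / ((Q * Q′) * g)   ≈⟨ /-*-/ (coefficient-denominator-≉0 d s) (1-x≉0 (q^suc≉1 d)) ⟨
      ((P * P′) / (Q * Q′)) * (b / g)   ∎
      where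
      P = poch (k / a) q d
      P′ = poch k q s
      Q = poch q q d
      Q′ = poch (a * q) q s
      b = 1# - (k / a) * q ^ d
      g = 1# - q ^ suc d

    coefficient-sucʳ : ∀ k d s → coefficient q a k d (suc s)
                                 ≈ coefficient q a k d s * ((1# - k * q ^ s) / (1# - (a * q) * q ^ s))
    coefficient-sucʳ k d s = begin
      (P * (P′ * b)) / (Q * (Q′ * g))   ≈⟨ /-cong (*-assoc P P′ b) (*-assoc Q Q′ g) ⟨
      ((P * P′) * b) / ((Q * Q′) * g)   ≈⟨ /-*-/ (coefficient-denominator-≉0 d s) (1-x≉0 ([aq]q^≉1 s)) ⟨
      ((P * P′) / (Q * Q′)) * (b / g)   ∎
      where
      P = poch (k / a) q d
      P′ = poch k q s
      Q = poch q q d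
      Q′ = poch (a * q) q s
      b = 1# - k * q ^ s
      g = 1# - (a * q) * q ^ s

  -- The recurrence of the certificate in Orthogonality.Step, written in κ = k/a, ι = a/k
  -- and the monomials A = a q^{2i}, v = q^{m+1}, w = q^r.
  certificate-identity : ∀ {κ ι} → κ * ι ≈ 1# → ∀ A v w →
    (1# - κ * w) * ((1# - A * (v * (v * w))) * ((1# - v) * (1# - κ * (A * v))))
      + (κ * (1# - A * (v * v))) * ((1# - ι) * ((1# - v * w) * (1# - κ * (A * (v * w)))))
    ≈ κ * (((1# - A * v) * (1# - ι * v)) * ((1# - κ * (A * (v * (v * w)))) * (1# - w)))
  certificate-identity {κ} {ι} κι≈1 A v w = begin
    b * G + (κ * ω) * ((1# - ι) * T)
      ≈⟨ +-congˡ (solve 4 (λ κ ω ι T → (κ :* ω) :* ((one :- ι) :* T) := ω :* ((κ :* (one :- ι)) :* T))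
                          refl κ ω ι T) ⟩
    b * G + ω * ((κ * (1# - ι)) * T)
      ≈⟨ +-congˡ (*-congˡ (*-congʳ κ[1-ι]≈κ-1)) ⟩
    b * G + ω * ((κ - 1#) * T)
      ≈⟨ solve 4 (λ A κ v w →
           (one :- κ :* w) :* ((one :- A :* (v :* (v :* w))) :* ((one :- v) :* (one :- κ :* (A :* v))))
             :+ (one :- A :* (v :* v)) :* ((κ :- one) :* ((one :- v :* w) :* (one :- κ :* (A :* (v :* w)))))
           := ((one :- A :* v) :* (κ :- v)) :* ((one :- κ :* (A :* (v :* (v :* w)))) :* (one :- w)))
         refl A κ v w ⟩
    ((1# - A * v) * (κ - v)) * R
      ≈⟨ *-congʳ (*-congˡ (κ[1-ιx]≈κ-x v)) ⟨
    ((1# - A * v) * (κ * (1# - ι * v))) * R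
      ≈⟨ solve 5 (λ κ ι x v R → (x :* (κ :* (one :- ι :* v))) :* R := κ :* ((x :* (one :- ι :* v)) :* R))
               refl κ ι (1# - A * v) v R ⟩
    κ * (((1# - A * v) * (1# - ι * v)) * R) ∎
    where
    b = 1# - κ * w
    G = (1# - A * (v * (v * w))) * ((1# - v) * (1# - κ * (A * v)))
    ω = 1# - A * (v * v)
    T = (1# - v * w) * (1# - κ * (A * (v * w)))
    R = (1# - κ * (A * (v * (v * w)))) * (1# - w)
    κ[1-ιx]≈κ-x : ∀ x → κ * (1# - ι * x) ≈ κ - x
    κ[1-ιx]≈κ-x x = begin
      κ * (1# - ι * x)    ≈⟨ solve 3 (λ κ ι x → κ :* (one :- ι :* x) := κ :- (κ :* ι) :* x) refl κ ι x ⟩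
      κ - (κ * ι) * x     ≈⟨ +-congˡ (-‿cong (*-congʳ κι≈1)) ⟩
      κ - 1# * x          ≈⟨ +-congˡ (-‿cong (*-identityˡ x)) ⟩
      κ - x               ∎
    κ[1-ι]≈κ-1 : κ * (1# - ι) ≈ κ - 1#
    κ[1-ι]≈κ-1 = trans (*-congˡ (1-cong (sym (*-identityʳ ι)))) (κ[1-ιx]≈κ-x 1#)

  telescoping-step : ∀ {X b₁ g₁ ω ω′ κ N G B B′ E} →
    ¬ g₁ ≈ 0# → ¬ ω ≈ 0# → ¬ ω′ ≈ 0# → ¬ E ≈ 0# → ¬ G ≈ 0# →
    B ≈ N * g₁ → b₁ * G + (κ * ω′) * E ≈ κ * B′ →
    (X * ((b₁ * ω) / g₁)) * (B / (ω * E)) + X * (((κ * ω′) * N) / G)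
      ≈ (X * (((κ * ω′) * N) / G)) * (B′ / (ω′ * E))
  telescoping-step {X} {b₁} {g₁} {ω} {ω′} {κ} {N} {G} {B} {B′} {E}
                   g₁≉0 ω≉0 ω′≉0 E≉0 G≉0 B≈Ng₁ recurrence = begin
    (X * ((b₁ * ω) / g₁)) * (B / (ω * E)) + X * ((κω′ * N) / G)
      ≈⟨ +-congʳ (*-assoc X _ _) ⟩
    X * (((b₁ * ω) / g₁) * (B / (ω * E))) + X * ((κω′ * N) / G)
      ≈⟨ distribˡ X _ _ ⟨
    X * (((b₁ * ω) / g₁) * (B / (ω * E)) + (κω′ * N) / G)
      ≈⟨ *-congˡ (+-congʳ (/-*-/ g₁≉0 ωE≉0)) ⟩
    X * (((b₁ * ω) * B) / (g₁ * (ω * E)) + (κω′ * N) / G)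
      ≈⟨ *-congˡ (+-congʳ (/-cross (*-≉0 g₁≉0 ωE≉0) E≉0 cancel-g₁ω)) ⟩
    X * ((b₁ * N) / E + (κω′ * N) / G)
      ≈⟨ *-congˡ (/-+-/ E≉0 G≉0) ⟩
    X * (((b₁ * N) * G + (κω′ * N) * E) / (E * G))
      ≈⟨ *-congˡ (/-cong factor-N refl) ⟩
    X * ((N * (κ * B′)) / (E * G))
      ≈⟨ *-congˡ (/-cross (*-≉0 G≉0 ω′E≉0) (*-≉0 E≉0 G≉0) cancel-ω′) ⟨
    X * (((κω′ * N) * B′) / (G * (ω′ * E)))
      ≈⟨ *-congˡ (/-*-/ G≉0 ω′E≉0) ⟨
    X * (((κω′ * N) / G) * (B′ / (ω′ * E)))
      ≈⟨ *-assoc X _ _ ⟨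
    (X * ((κω′ * N) / G)) * (B′ / (ω′ * E)) ∎
    where
    κω′ = κ * ω′
    ωE≉0 = *-≉0 ω≉0 E≉0
    ω′E≉0 = *-≉0 ω′≉0 E≉0
    cancel-g₁ω : ((b₁ * ω) * B) * E ≈ (b₁ * N) * (g₁ * (ω * E))
    cancel-g₁ω = begin
      ((b₁ * ω) * B) * E
        ≈⟨ *-congʳ (*-congˡ B≈Ng₁) ⟩
      ((b₁ * ω) * (N * g₁)) * E
        ≈⟨ solve 5 (λ b ω N g E → ((b :* ω) :* (N :* g)) :* E := (b :* N) :* (g :* (ω :* E)))
                 refl b₁ ω N g₁ E ⟩
      (b₁ * N) * (g₁ * (ω * E)) ∎
    factor-N : (b₁ * N) * G + (κω′ * N) * E ≈ N * (κ * B′)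
    factor-N = begin
      (b₁ * N) * G + (κω′ * N) * E
        ≈⟨ solve 5 (λ b N G x E → (b :* N) :* G :+ (x :* N) :* E := N :* (b :* G :+ x :* E))
                 refl b₁ N G κω′ E ⟩
      N * (b₁ * G + κω′ * E)
        ≈⟨ *-congˡ recurrence ⟩
      N * (κ * B′) ∎
    cancel-ω′ : ((κω′ * N) * B′) * (E * G) ≈ (N * (κ * B′)) * (G * (ω′ * E))
    cancel-ω′ = solve 6 (λ κ ω′ N B′ E G → ((κ :* ω′ :* N) :* B′) :* (E :* G)
                                          := (N :* (κ :* B′)) :* (G :* (ω′ :* E)))
                        refl κ ω′ N B′ E G

  record Nondegenerate (q a k : Carrier) : Set ℓ where
    field
      a≉0     : ¬ a ≈ 0#
      k≉0     : ¬ k ≈ 0#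
      a/k≉1   : ¬ a / k ≈ 1#
      q^suc≉1 : ∀ s → ¬ q ^ suc s ≈ 1#
      aq^≉1   : ∀ s → ¬ a * q ^ s ≈ 1#
      kq^≉1   : ∀ s → ¬ k * q ^ s ≈ 1#

  generic⇒nondegenerate : ∀ {q a k} → Generic q a k → Nondegenerate q a k
  generic⇒nondegenerate (_ , a≉0 , k≉0 , q^≉1 , aq^≉1 , kq^≉1 , a/k·q^≉1 , _) = record
    { a≉0     = a≉0
    ; k≉0     = k≉0
    ; a/k≉1   = λ a/k≈1 → a/k·q^≉1 (+ 0) (trans (*-identityʳ _) a/k≈1)
    ; q^suc≉1 = λ s → q^≉1 (+ suc s) (λ ())
    ; aq^≉1   = λ s → aq^≉1 (+ s)
    ; kq^≉1   = λ s → kq^≉1 (+ s)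
    }

  Generic-swap : ∀ {q a k} → Generic q a k → Generic q k a
  Generic-swap (q≉0 , a≉0 , k≉0 , q^≉1 , aq^≉1 , kq^≉1 , a/k·q^≉1 , k/a·q^≉1) =
    (q≉0 , k≉0 , a≉0 , q^≉1 , kq^≉1 , aq^≉1 , k/a·q^≉1 , a/k·q^≉1)

  module Orthogonality {q a k : Carrier} (nd : Nondegenerate q a k) where
    open Nondegenerate nd

    κ ι : Carrier
    κ = k / a
    ι = a / k

    ω : ℕ → Carrier
    ω j = 1# - a * q ^ (2 ℕ.* j)

    kernel : ℕ → ℕ → ℕ → Carrier
    kernel n i j =
      coefficient q a k (n ∸ j) (n ℕ.+ j) * (weight q a k j * coefficient q k a (j ∸ i) (j ℕ.+ i))

    kernel-expansion : ∀ n j (f : ℕ → Carrier) →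
      coefficient q a k (n ∸ j) (n ℕ.+ j) *
        (weight q a k j * sumTo j (λ i → coefficient q k a (j ∸ i) (j ℕ.+ i) * f i))
      ≈ sumTo j (λ i → kernel n i j * f i)
    kernel-expansion n j f = begin
      C * (W * sumTo j (λ i → C′ i * f i))     ≈⟨ *-congˡ (sumTo-*ˡ j W _) ⟩
      C * sumTo j (λ i → W * (C′ i * f i))     ≈⟨ sumTo-*ˡ j C _ ⟩
      sumTo j (λ i → C * (W * (C′ i * f i)))   ≈⟨ sumTo-cong j (λ i _ → reassociate i) ⟨
      sumTo j (λ i → kernel n i j * f i)       ∎
      where
      C = coefficient q a k (n ∸ j) (n ℕ.+ j)
      W = weight q a k j
      C′ = λ i → coefficient q k a (j ∸ i) (j ℕ.+ i)
      reassociate : ∀ i → kernel n i j * f i ≈ C * (W * (C′ i * f i))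
      reassociate i = trans (*-assoc C _ _) (*-congˡ (*-assoc W _ _))

    -- Gosper's certificate: Σ_{l=i}^{j} kernel n i l = kernel n i j * certificate n i j
    -- whenever i ≤ j ≤ n and i < n.
    numerator : ℕ → ℕ → ℕ → Carrier
    numerator n i j = ((1# - a * q ^ (j ℕ.+ i)) * (1# - ι * q ^ (j ∸ i)))
                    * ((1# - k * q ^ (n ℕ.+ j)) * (1# - q ^ (n ∸ j)))

    denominator : ℕ → ℕ → Carrier
    denominator n i = (1# - ι) * ((1# - q ^ (n ∸ i)) * (1# - k * q ^ (n ℕ.+ i)))

    certificate : ℕ → ℕ → ℕ → Carrier
    certificate n i j = numerator n i j / (ω j * denominator n i)

    q^-cong : ∀ {e e′} → e ≡ e′ → q ^ e ≈ q ^ e′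
    q^-cong e≡e′ = reflexive (≡.cong (q ^_) e≡e′)

    κι≈1 : κ * ι ≈ 1#
    κι≈1 = begin
      (k * a ⁻¹) * (a * k ⁻¹)
        ≈⟨ solve 4 (λ k a a′ k′ → (k :* a′) :* (a :* k′) := (k :* k′) :* (a :* a′)) refl k a (a ⁻¹) (k ⁻¹) ⟩
      (k * k ⁻¹) * (a * a ⁻¹)   ≈⟨ *-cong (⁻¹-inverse k≉0) (⁻¹-inverse a≉0) ⟩
      1# * 1#                   ≈⟨ *-identityʳ 1# ⟩
      1#                        ∎

    k≈κa : k ≈ κ * a
    k≈κa = begin
      k                  ≈⟨ *-identityʳ k ⟨
      k * 1#             ≈⟨ *-congˡ (⁻¹-inverse a≉0) ⟨
      k * (a * a ⁻¹)     ≈⟨ *-congˡ (*-comm a _) ⟩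
      k * (a ⁻¹ * a)     ≈⟨ *-assoc k _ a ⟨
      κ * a              ∎

    ω≉0 : ∀ j → ¬ ω j ≈ 0#
    ω≉0 j = 1-x≉0 (aq^≉1 (2 ℕ.* j))

    denominator-≉0 : ∀ {n i} → i < n → ¬ denominator n i ≈ 0#
    denominator-≉0 {n} {i} i<n =
      *-≉0 (1-x≉0 a/k≉1) (*-≉0 (1-x≉0 q^[n∸i]≉1) (1-x≉0 (kq^≉1 (n ℕ.+ i))))
      where
      q^[n∸i]≉1 : ¬ q ^ (n ∸ i) ≈ 1#
      q^[n∸i]≉1 = ≡.subst (λ e → ¬ q ^ e ≈ 1#) (≡.sym (ℕ.+-∸-assoc 1 i<n)) (q^suc≉1 (n ∸ suc i))

    module Step (i m r : ℕ) where
      j n s d s′ : ℕ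
      j = i ℕ.+ m
      n = suc (j ℕ.+ r)
      s = n ℕ.+ j
      d = j ∸ i
      s′ = j ℕ.+ i

      n∸j≡1+r : n ∸ j ≡ suc r
      n∸j≡1+r = ≡.trans (ℕ.+-∸-assoc 1 (ℕ.m≤m+n j r)) (≡.cong suc (ℕ.m+n∸m≡n j r))

      n∸[1+j]≡r : n ∸ suc j ≡ r
      n∸[1+j]≡r = ℕ.m+n∸m≡n j r

      [1+j]∸i≡1+d : suc j ∸ i ≡ suc d
      [1+j]∸i≡1+d = ℕ.+-∸-assoc 1 (ℕ.m≤m+n i m)

      n∸i≡1+m+r : n ∸ i ≡ suc m ℕ.+ r
      n∸i≡1+m+r = ≡.trans (≡.cong (_∸ i) n≡i+[1+m+r]) (ℕ.m+n∸m≡n i (suc m ℕ.+ r))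
        where
        n≡i+[1+m+r] : suc (i ℕ.+ m ℕ.+ r) ≡ i ℕ.+ (suc m ℕ.+ r)
        n≡i+[1+m+r] = ℕ-solve (i ∷ m ∷ r ∷ [])

      1+s≡2i+[2+2m+r] : suc (suc (i ℕ.+ m ℕ.+ r) ℕ.+ (i ℕ.+ m)) ≡ i ℕ.+ i ℕ.+ (suc m ℕ.+ (suc m ℕ.+ r))
      1+s≡2i+[2+2m+r] = ℕ-solve (i ∷ m ∷ r ∷ [])

      n+1+j≡2i+[2+2m+r] : suc (i ℕ.+ m ℕ.+ r) ℕ.+ suc (i ℕ.+ m) ≡ i ℕ.+ i ℕ.+ (suc m ℕ.+ (suc m ℕ.+ r))
      n+1+j≡2i+[2+2m+r] = ℕ-solve (i ∷ m ∷ r ∷ [])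

      2[1+j]≡2i+[2+2m] : 2 ℕ.* suc (i ℕ.+ m) ≡ i ℕ.+ i ℕ.+ (suc m ℕ.+ suc m)
      2[1+j]≡2i+[2+2m] = ℕ-solve (i ∷ m ∷ [])

      1+s′≡2i+[1+m] : suc (i ℕ.+ m ℕ.+ i) ≡ i ℕ.+ i ℕ.+ suc m
      1+s′≡2i+[1+m] = ℕ-solve (i ∷ m ∷ [])

      n+i≡2i+[1+m+r] : suc (i ℕ.+ m ℕ.+ r) ℕ.+ i ≡ i ℕ.+ i ℕ.+ (suc m ℕ.+ r)
      n+i≡2i+[1+m+r] = ℕ-solve (i ∷ m ∷ r ∷ [])

      A v w : Carrier
      A = a * q ^ (i ℕ.+ i)
      v = q ^ suc m
      w = q ^ r

      a·q^ : ∀ {e} e′ → e ≡ i ℕ.+ i ℕ.+ e′ → a * q ^ e ≈ A * q ^ e′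
      a·q^ {e} e′ e≡ = begin
        a * q ^ e                      ≈⟨ *-congˡ (trans (q^-cong e≡) (^-+ q (i ℕ.+ i) e′)) ⟩
        a * (q ^ (i ℕ.+ i) * q ^ e′)   ≈⟨ *-assoc a _ _ ⟨
        A * q ^ e′                     ∎

      k·q^ : ∀ {e} e′ → e ≡ i ℕ.+ i ℕ.+ e′ → k * q ^ e ≈ κ * (A * q ^ e′)
      k·q^ {e} e′ e≡ = begin
        k * q ^ e          ≈⟨ *-congʳ k≈κa ⟩
        (κ * a) * q ^ e    ≈⟨ *-assoc κ a _ ⟩
        κ * (a * q ^ e)    ≈⟨ *-congˡ (a·q^ e′ e≡) ⟩
        κ * (A * q ^ e′)   ∎

      q^[1+m+r] : q ^ (suc m ℕ.+ r) ≈ v * w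
      q^[1+m+r] = ^-+ q (suc m) r

      q^[2+2m+r] : q ^ (suc m ℕ.+ (suc m ℕ.+ r)) ≈ v * (v * w)
      q^[2+2m+r] = trans (^-+ q (suc m) _) (*-congˡ q^[1+m+r])

      b₁ g₁ b₂ g₂ b₃ g₃ b₄ g₄ N G : Carrier
      b₁ = 1# - κ * q ^ r
      g₁ = 1# - q ^ suc r
      b₂ = 1# - k * q ^ s
      g₂ = 1# - (a * q) * q ^ s
      b₃ = 1# - ι * q ^ d
      g₃ = 1# - q ^ suc d
      b₄ = 1# - a * q ^ s′
      g₄ = 1# - (k * q) * q ^ s′
      N = b₂ * (b₃ * b₄)
      G = g₂ * (g₃ * g₄)

      g₁≉0 : ¬ g₁ ≈ 0#
      g₁≉0 = 1-x≉0 (q^suc≉1 r)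

      g₂≉0 : ¬ g₂ ≈ 0#
      g₂≉0 = 1-x≉0 ([aq]q^≉1 q^suc≉1 aq^≉1 s)

      g₃≉0 : ¬ g₃ ≈ 0#
      g₃≉0 = 1-x≉0 (q^suc≉1 d)

      g₄≉0 : ¬ g₄ ≈ 0#
      g₄≉0 = 1-x≉0 ([aq]q^≉1 q^suc≉1 kq^≉1 s′)

      G⁻¹≈g₂⁻¹g₃⁻¹g₄⁻¹ : G ⁻¹ ≈ g₂ ⁻¹ * (g₃ ⁻¹ * g₄ ⁻¹)
      G⁻¹≈g₂⁻¹g₃⁻¹g₄⁻¹ = trans (⁻¹-distrib-* g₂≉0 (*-≉0 g₃≉0 g₄≉0)) (*-congˡ (⁻¹-distrib-* g₃≉0 g₄≉0))

      certificate-recurrence : b₁ * G + (κ * ω (suc j)) * denominator n i ≈ κ * numerator n i (suc j)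
      certificate-recurrence = begin
        b₁ * G + (κ * ω (suc j)) * denominator n i
          ≈⟨ +-cong (*-congˡ (*-cong (1-cong g₂-monomial) (*-cong (1-cong g₃-monomial) (1-cong g₄-monomial))))
                    (*-cong (*-congˡ (1-cong ω-monomial))
                            (*-congˡ (*-cong (1-cong E₁-monomial) (1-cong E₂-monomial)))) ⟩
        (1# - κ * w) * ((1# - A * (v * (v * w))) * ((1# - v) * (1# - κ * (A * v))))
          + (κ * (1# - A * (v * v))) * ((1# - ι) * ((1# - v * w) * (1# - κ * (A * (v * w)))))
          ≈⟨ certificate-identity κι≈1 A v w ⟩
        κ * (((1# - A * v) * (1# - ι * v)) * ((1# - κ * (A * (v * (v * w)))) * (1# - w)))
          ≈⟨ *-congˡ (*-cong (*-cong (1-cong B₄-monomial) (1-cong (*-congˡ B₃-monomial)))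
                             (*-cong (1-cong B₂-monomial) (1-cong B₁-monomial))) ⟨
        κ * numerator n i (suc j) ∎
        where
        g₂-monomial : (a * q) * q ^ s ≈ A * (v * (v * w))
        g₂-monomial = trans (*-assoc a q _) (trans (a·q^ _ 1+s≡2i+[2+2m+r]) (*-congˡ q^[2+2m+r]))
        g₃-monomial : q ^ suc d ≈ v
        g₃-monomial = q^-cong (≡.cong suc (ℕ.m+n∸m≡n i m))
        g₄-monomial : (k * q) * q ^ s′ ≈ κ * (A * v)
        g₄-monomial = trans (*-assoc k q _) (k·q^ _ 1+s′≡2i+[1+m])
        ω-monomial : a * q ^ (2 ℕ.* suc j) ≈ A * (v * v)
        ω-monomial = trans (a·q^ _ 2[1+j]≡2i+[2+2m]) (*-congˡ (^-+ q (suc m) (suc m)))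
        E₁-monomial : q ^ (n ∸ i) ≈ v * w
        E₁-monomial = trans (q^-cong n∸i≡1+m+r) q^[1+m+r]
        E₂-monomial : k * q ^ (n ℕ.+ i) ≈ κ * (A * (v * w))
        E₂-monomial = trans (k·q^ _ n+i≡2i+[1+m+r]) (*-congˡ (*-congˡ q^[1+m+r]))
        B₄-monomial : a * q ^ (suc j ℕ.+ i) ≈ A * v
        B₄-monomial = a·q^ _ 1+s′≡2i+[1+m]
        B₃-monomial : q ^ (suc j ∸ i) ≈ v
        B₃-monomial = trans (q^-cong [1+j]∸i≡1+d) g₃-monomial
        B₂-monomial : k * q ^ (n ℕ.+ suc j) ≈ κ * (A * (v * (v * w)))
        B₂-monomial = trans (k·q^ _ n+1+j≡2i+[2+2m+r]) (*-congˡ (*-congˡ q^[2+2m+r]))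
        B₁-monomial : q ^ (n ∸ suc j) ≈ w
        B₁-monomial = q^-cong n∸[1+j]≡r

      C C′ X : Carrier
      C = coefficient q a k r s
      C′ = coefficient q k a d s′
      X = (C * C′) * (κ ^ j * (1# - a) ⁻¹)

      kernel-at-j : kernel n i j ≈ X * ((b₁ * ω j) / g₁)
      kernel-at-j = begin
        kernel n i j
          ≡⟨ ≡.cong (λ e → coefficient q a k e s * (weight q a k j * C′)) n∸j≡1+r ⟩
        coefficient q a k (suc r) s * (((ω j / (1# - a)) * κ ^ j) * C′)
          ≈⟨ *-congʳ (coefficient-sucˡ q^suc≉1 aq^≉1 k r s) ⟩
        (C * (b₁ / g₁)) * (((ω j / (1# - a)) * κ ^ j) * C′)
          ≈⟨ solve 7 (λ C b g′ ω z′ K C′ → (C :* (b :* g′)) :* (((ω :* z′) :* K) :* C′)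
                                          := (C :* C′) :* (K :* z′) :* ((b :* ω) :* g′))
                   refl C b₁ (g₁ ⁻¹) (ω j) ((1# - a) ⁻¹) (κ ^ j) C′ ⟩
        X * ((b₁ * ω j) / g₁) ∎

      kernel-at-suc-j : kernel n i (suc j) ≈ X * (((κ * ω (suc j)) * N) / G)
      kernel-at-suc-j = begin
        kernel n i (suc j)
          ≡⟨ ≡.cong₂ (λ e f → coefficient q a k e f * (W′ * coefficient q k a (suc j ∸ i) (suc s′)))
                     n∸[1+j]≡r (ℕ.+-suc n j) ⟩
        coefficient q a k r (suc s) * (W′ * coefficient q k a (suc j ∸ i) (suc s′))
          ≡⟨ ≡.cong (λ e → coefficient q a k r (suc s) * (W′ * coefficient q k a e (suc s′))) [1+j]∸i≡1+d ⟩
        coefficient q a k r (suc s) * (W′ * coefficient q k a (suc d) (suc s′))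
          ≈⟨ *-cong (coefficient-sucʳ q^suc≉1 aq^≉1 k r s)
                    (*-congˡ (trans (coefficient-sucˡ q^suc≉1 kq^≉1 a d (suc s′))
                                    (*-congʳ (coefficient-sucʳ q^suc≉1 kq^≉1 a d s′)))) ⟩
        (C * (b₂ / g₂)) * (((ω (suc j) / (1# - a)) * (κ * κ ^ j)) * ((C′ * (b₄ / g₄)) * (b₃ / g₃)))
          ≈⟨ solve 12 (λ C b₂ g₂′ ω′ z′ κ K C′ b₄ g₄′ b₃ g₃′ →
                 (C :* (b₂ :* g₂′)) :* (((ω′ :* z′) :* (κ :* K)) :* ((C′ :* (b₄ :* g₄′)) :* (b₃ :* g₃′)))
                 := ((C :* C′) :* (K :* z′)) :* (((κ :* ω′) :* (b₂ :* (b₃ :* b₄))) :* (g₂′ :* (g₃′ :* g₄′))))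
               refl C b₂ (g₂ ⁻¹) (ω (suc j)) ((1# - a) ⁻¹) κ (κ ^ j) C′ b₄ (g₄ ⁻¹) b₃ (g₃ ⁻¹) ⟩
        X * (((κ * ω (suc j)) * N) * (g₂ ⁻¹ * (g₃ ⁻¹ * g₄ ⁻¹)))
          ≈⟨ *-congˡ (*-congˡ G⁻¹≈g₂⁻¹g₃⁻¹g₄⁻¹) ⟨
        X * (((κ * ω (suc j)) * N) / G) ∎
        where
        W′ = weight q a k (suc j)

      numerator-at-j : numerator n i j ≈ N * g₁
      numerator-at-j = begin
        (b₄ * b₃) * (b₂ * (1# - q ^ (n ∸ j)))   ≈⟨ *-congˡ (*-congˡ (1-cong (q^-cong n∸j≡1+r))) ⟩
        (b₄ * b₃) * (b₂ * g₁)
          ≈⟨ solve 4 (λ b₄ b₃ b₂ g₁ → (b₄ :* b₃) :* (b₂ :* g₁) := (b₂ :* (b₃ :* b₄)) :* g₁) refl b₄ b₃ b₂ g₁ ⟩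
        N * g₁                                 ∎

      kernel-step : kernel n i j * certificate n i j + kernel n i (suc j)
                    ≈ kernel n i (suc j) * certificate n i (suc j)
      kernel-step = begin
        kernel n i j * certificate n i j + kernel n i (suc j)
          ≈⟨ +-cong (*-congʳ kernel-at-j) kernel-at-suc-j ⟩
        (X * ((b₁ * ω j) / g₁)) * certificate n i j + X * (((κ * ω (suc j)) * N) / G)
          ≈⟨ telescoping-step g₁≉0 (ω≉0 j) (ω≉0 (suc j)) (denominator-≉0 i<n) (*-≉0 g₂≉0 (*-≉0 g₃≉0 g₄≉0))
                              numerator-at-j certificate-recurrence ⟩
        (X * (((κ * ω (suc j)) * N) / G)) * certificate n i (suc j)
          ≈⟨ *-congʳ kernel-at-suc-j ⟨
        kernel n i (suc j) * certificate n i (suc j) ∎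
        where
        i<n : i < n
        i<n = s≤s (ℕ.≤-trans (ℕ.m≤m+n i m) (ℕ.m≤m+n j r))

    certificate-start : ∀ {n i} → i < n → certificate n i i ≈ 1#
    certificate-start {n} {i} i<n = begin
      numerator n i i / D   ≈⟨ *-congʳ numerator≈D ⟩
      D / D                 ≈⟨ ⁻¹-inverse (*-≉0 (ω≉0 i) (denominator-≉0 i<n)) ⟩
      1#                    ∎
      where
      D = ω i * denominator n i
      K = 1# - k * q ^ (n ℕ.+ i)
      Q = 1# - q ^ (n ∸ i)
      numerator≈D : numerator n i i ≈ D
      numerator≈D = begin
        ((1# - a * q ^ (i ℕ.+ i)) * (1# - ι * q ^ (i ∸ i))) * (K * Q)
          ≈⟨ *-congʳ (*-cong (1-cong (*-congˡ (q^-cong (≡.cong (i ℕ.+_) (ℕ.+-identityʳ i)))))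
                             (1-cong (sym (trans (*-congˡ (q^-cong (ℕ.n∸n≡0 i))) (*-identityʳ ι))))) ⟨
        (ω i * (1# - ι)) * (K * Q)
          ≈⟨ solve 4 (λ ω ι K Q → (ω :* (one :- ι)) :* (K :* Q) := ω :* ((one :- ι) :* (Q :* K)))
                   refl (ω i) ι K Q ⟩
        D ∎

    certificate-end : ∀ n i → certificate n i n ≈ 0#
    certificate-end n i = begin
      numerator n i n / (ω n * denominator n i)
        ≈⟨ *-congʳ (trans (*-congˡ (trans (*-congˡ 1-q^[n∸n]≈0) (zeroʳ _))) (zeroʳ _)) ⟩
      0# / (ω n * denominator n i)
        ≈⟨ zeroˡ _ ⟩
      0# ∎
      where
      1-q^[n∸n]≈0 : 1# - q ^ (n ∸ n) ≈ 0#
      1-q^[n∸n]≈0 = trans (1-cong (q^-cong (ℕ.n∸n≡0 n))) (-‿inverseʳ 1#)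

    kernel-sum-off-diagonal : ∀ {n i} → i < n → sumFrom i (suc (n ∸ i)) (kernel n i) ≈ 0#
    kernel-sum-off-diagonal {n} {i} i<n = begin
      sumFrom i (suc (n ∸ i)) (kernel n i)
        ≈⟨ sumFrom-telescope (kernel n i) (certificate n i) (ℕ.<⇒≤ i<n) (certificate-start i<n) step ⟩
      kernel n i n * certificate n i n
        ≈⟨ *-congˡ (certificate-end n i) ⟩
      kernel n i n * 0#
        ≈⟨ zeroʳ _ ⟩
      0# ∎
      where
      Step-at : ℕ → ℕ → Set ℓ
      Step-at n j = kernel n i j * certificate n i j + kernel n i (suc j)
                    ≈ kernel n i (suc j) * certificate n i (suc j)
      step : ∀ m → i ℕ.+ m < n → Step-at n (i ℕ.+ m)
      step m i+m<n = ≡.subst (λ n → Step-at n (i ℕ.+ m)) (ℕ.m+[n∸m]≡n i+m<n)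
                             (Step.kernel-step i m (n ∸ suc (i ℕ.+ m)))

    kernel-diagonal : ∀ n → kernel n n n ≈ ((1# - k) / (1# - k * q ^ (2 ℕ.* n))) * κ ^ n
    kernel-diagonal n = begin
      kernel n n n
        ≡⟨ ≡.cong (λ d → coefficient q a k d M * (weight q a k n * coefficient q k a d M)) (ℕ.n∸n≡0 n) ⟩
      coefficient q a k 0 M * (((ω n / z) * κ ^ n) * coefficient q k a 0 M)
        ≈⟨ *-cong (coefficient-zeroˡ q a k M) (*-congˡ (coefficient-zeroˡ q k a M)) ⟩
      (Pk / Qa) * (((ω n / z) * κ ^ n) * (Pa / Qk))
        ≈⟨ solve 7 (λ Pk Qa′ ω z′ K Pa Qk′ → (Pk :* Qa′) :* (((ω :* z′) :* K) :* (Pa :* Qk′))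
                                            := ((Pk :* Qa′) :* ((ω :* z′) :* (Pa :* Qk′))) :* K)
                 refl Pk (Qa ⁻¹) (ω n) (z ⁻¹) (κ ^ n) Pa (Qk ⁻¹) ⟩
      ((Pk / Qa) * ((ω n / z) * (Pa / Qk))) * κ ^ n
        ≈⟨ *-congʳ (*-congˡ (/-*-/ z≉0 Qk≉0)) ⟩
      ((Pk / Qa) * ((ω n * Pa) / (z * Qk))) * κ ^ n
        ≈⟨ *-congʳ (/-*-/ Qa≉0 (*-≉0 z≉0 Qk≉0)) ⟩
      ((Pk * (ω n * Pa)) / (Qa * (z * Qk))) * κ ^ n
        ≈⟨ *-congʳ (/-cross (*-≉0 Qa≉0 (*-≉0 z≉0 Qk≉0)) (1-x≉0 (kq^≉1 (2 ℕ.* n))) cross) ⟩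
      ((1# - k) / (1# - k * q ^ (2 ℕ.* n))) * κ ^ n ∎
      where
      M = n ℕ.+ n
      z = 1# - a
      Pk = poch k q M
      Pa = poch a q M
      Qa = poch (a * q) q M
      Qk = poch (k * q) q M
      z≉0 : ¬ z ≈ 0#
      z≉0 = 1-x≉0 (λ a≈1 → aq^≉1 0 (trans (*-identityʳ a) a≈1))
      Qa≉0 : ¬ Qa ≈ 0#
      Qa≉0 = poch-≉0 ([aq]q^≉1 q^suc≉1 aq^≉1) M
      Qk≉0 : ¬ Qk ≈ 0#
      Qk≉0 = poch-≉0 ([aq]q^≉1 q^suc≉1 kq^≉1) M
      q^2n≈q^M : q ^ (2 ℕ.* n) ≈ q ^ M
      q^2n≈q^M = q^-cong (≡.cong (n ℕ.+_) (ℕ.+-identityʳ n))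
      cross : (Pk * (ω n * Pa)) * (1# - k * q ^ (2 ℕ.* n)) ≈ (1# - k) * (Qa * (z * Qk))
      cross = begin
        (Pk * (ω n * Pa)) * (1# - k * q ^ (2 ℕ.* n))
          ≈⟨ solve 4 (λ Pk ω Pa κ → (Pk :* (ω :* Pa)) :* κ := (Pk :* κ) :* (Pa :* ω))
                   refl Pk (ω n) Pa (1# - k * q ^ (2 ℕ.* n)) ⟩
        (Pk * (1# - k * q ^ (2 ℕ.* n))) * (Pa * ω n)
          ≈⟨ *-cong (*-congˡ (1-cong (*-congˡ q^2n≈q^M))) (*-congˡ (1-cong (*-congˡ q^2n≈q^M))) ⟩
        (Pk * (1# - k * q ^ M)) * (Pa * (1# - a * q ^ M))
          ≈⟨ *-cong (poch-suc k q M) (poch-suc a q M) ⟩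
        ((1# - k) * Qk) * (z * Qa)
          ≈⟨ solve 4 (λ k′ Qk z Qa → (k′ :* Qk) :* (z :* Qa) := k′ :* (Qa :* (z :* Qk)))
                   refl (1# - k) Qk z Qa ⟩
        (1# - k) * (Qa * (z * Qk)) ∎

    kernel-sum-diagonal : ∀ n → sumFrom n (suc (n ∸ n)) (kernel n n)
                                ≈ ((1# - k) / (1# - k * q ^ (2 ℕ.* n))) * κ ^ n
    kernel-sum-diagonal n = trans (sumFrom-singleton n (kernel n n)) (kernel-diagonal n)

corollary2p3 : {c ℓ : Level} (F : Field c ℓ) (q : Field.Carrier F)
    (α β : WP.Family F) → WP.IsWPBaileyPair F q α β →
      WP.IsWPBaileyPair F q (WP.α′ F q β) (WP.β′ F q α)
corollary2p3 F q α β isPair a k generic n = sym (begin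
    sumTo n (λ j → coefficient q a k (n ∸ j) (n ℕ.+ j) * (weight q a k j * β j k a))
      ≈⟨ sumTo-cong n (λ j _ → *-congˡ (*-congˡ (isPair k a (Generic-swap generic) j))) ⟩
    sumTo n (λ j → coefficient q a k (n ∸ j) (n ℕ.+ j) *
                   (weight q a k j * sumTo j (λ i → coefficient q k a (j ∸ i) (j ℕ.+ i) * α i k a)))
      ≈⟨ sumTo-cong n (λ j _ → kernel-expansion n j (λ i → α i k a)) ⟩
    sumTo n (λ j → sumTo j (λ i → kernel n i j * α i k a))
      ≈⟨ sumTo-triangle n (λ j i → kernel n i j * α i k a) ⟩
    sumTo n (λ i → sumFrom i (suc (n ∸ i)) (λ j → kernel n i j * α i k a))
      ≈⟨ sumTo-cong n (λ i _ → sumFrom-*ʳ i (suc (n ∸ i)) (kernel n i) (α i k a)) ⟨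
    sumTo n (λ i → sumFrom i (suc (n ∸ i)) (kernel n i) * α i k a)
      ≈⟨ sumTo-last n _ (λ i i<n → trans (*-congʳ (kernel-sum-off-diagonal i<n)) (zeroˡ _)) ⟩
    sumFrom n (suc (n ∸ n)) (kernel n n) * α n k a
      ≈⟨ *-congʳ (kernel-sum-diagonal n) ⟩
    β′ q α n a k ∎)
  where
  open Field F
  open WP F
  open FiniteSums F
  open WPBaileyInversion F
  open Orthogonality (generic⇒nondegenerate generic)
  open import Relation.Binary.Reasoning.Setoid setoid
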